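{- Let $\mu=(\mathrm{Val},(\mathcal P,\mathcal O),\varsigma)$ be a model for the predicate symbols $\mathrm{broadcast},\mathrm{echo},\mathrm{ready},\mathrm{deliver}$ whose semitopology $(\mathcal P,\mathcal O)$ is 3-twined, and suppose every axiom of $\mathrm{ThyBB}$ is valid in $\mu$. Then for every $v\in\mathrm{Val}$, $$\models\mathrm{deliver}(v)\to_w\mathsf{Somewhere}\,\mathrm{broadcast}(v).$$
   Context: Truth values: $\mathbf 3=\{\mathbf f,\mathbf b,\mathbf t\}$ totally ordered by $\mathbf f<\mathbf b<\mathbf t$; $\wedge,\vee$ are min and max, $\bigwedge,\bigvee$ are infimum and supremum. Negation: $\neg\mathbf t=\mathbf f$, $\neg\mathbf b=\mathbf b$, $\neg\mathbf f=\mathbf t$. Modalities: $\mathsf T x=\mathbf t$ if $x=\mathbf t$, else $\mathbf f$; $\mathsf B x=\mathbf t$ if $x=\mathbf b$, else $\mathbf f$; $\mathsf{TF}x=\mathbf t$ if $x\in\{\mathbf t,\mathbf f\}$, else $\mathbf f$. Weak implication: $x\to_w y:=\neg x\vee y$. A truth value is valid iff it lies in $\{\mathbf t,\mathbf b\}$. A semitopology $(\mathcal P,\mathcal O)$ is a set $\mathcal P$ with a family $\mathcal O$ of subsets containing $\mathcal P$ and closed under arbitrary (including empty) unions; $\mathcal O^{\neq\emptyset}$ is the set of nonempty members of $\mathcal O$. It is 3-twined if any three members of $\mathcal O^{\neq\emptyset}$ have nonempty intersection. For $f:\mathcal P\to\mathbf 3$: $\mathsf{Everywhere} f=\bigwedge_{p}f(p)$,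 $\mathsf{Somewhere} f=\bigvee_p f(p)$, $\mathsf{Quorum} f=\bigvee_{O\in\mathcal O^{\neq\emptyset}}\bigwedge_{p\in O}f(p)$, $\mathsf{Contraquorum} f=\bigwedge_{O\in\mathcal O^{\neq\emptyset}}\bigvee_{p\in O}f(p)$. Logic: a model $\mu=(\mathrm{Val},(\mathcal P,\mathcal O),\varsigma)$ consists of a nonempty set $\mathrm{Val}$, a semitopology, and for each predicate symbol $R$ a function $\varsigma(R):\mathcal P\to\mathrm{Val}\to\mathbf 3$. Formulas are built from atoms $R(t)$, value equalities $v\doteq v'$ (denoting $\mathbf t$ if $v=v'$, else $\mathbf f$), connectives $\neg,\wedge,\vee,\to_w$, modalities $\mathsf T,\mathsf B,\mathsf{TF}$, operators $\mathsf{Everywhere},\mathsf{Somewhere},\mathsf{Quorum},\mathsf{Contraquorum}$ and quantifiers over $\mathrm{Val}$. Denotation $[\![\phi]\!]:\mathcal P\to\mathbf 3$: $[\![R(v)]\!](p)=\varsigma(R)(p)(v)$; connectives and modalities pointwise in $p$; $[\![\mathsf{Quorum}\,\phi]\!](p)=\mathsf{Quorum}([\![\phi]\!])$ for all $p$, likewise for the other three operators; $[\![\exists a.\phi]\!](p)=\bigvee_{v}[\![\phi[a:=v]]\!](p)$, $[\![\forall a.\phi]\!](p)=\bigwedge_{v}[\![\phi[a:=v]]\!](p)$; $[\![\exists_{01}a.\phi]\!](p)=\bigwedge_{v,v'}\big(([\![\phi[a:=v]]\!](p)\wedge[\![\phi[a:=v']]\!](p))\to_w (v\doteq v')\big)$;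 $\exists_1 a.\phi:=(\exists_{01}a.\phi)\wedge(\exists a.\phi)$. $p\models\phi$ iff $[\![\phi]\!](p)\in\{\mathbf t,\mathbf b\}$; $\models\phi$ iff $p\models\phi$ for all $p$. $\mathrm{correct}(R):=\forall a.\mathsf{TF}R(a)$, $\mathrm{incorrect}(R):=\forall a.\mathsf B R(a)$. Axioms with a free variable $a$ are universally quantified over $a$; an axiom is valid in $\mu$ if $\models$ it. $\mathrm{ThyBB}$ consists of: BrDeliver?: $\mathrm{deliver}(a)\to_w\mathsf{Quorum}\,\mathrm{ready}(a)$; BrReady?: $\mathrm{ready}(a)\to_w\mathsf{Quorum}\,\mathrm{echo}(a)$; BrEcho?: $\mathrm{echo}(a)\to_w\mathsf{Somewhere}\,\mathrm{broadcast}(a)$; BrEcho01: $\exists_{01}a.\mathrm{echo}(a)$; BrBroadcast1: $\exists_1 a.\mathsf{Somewhere}\,\mathrm{broadcast}(a)$; BrDeliver!: $\mathsf{Quorum}\,\mathrm{ready}(a)\to_w\mathrm{deliver}(a)$; BrReady!: $\mathsf{Quorum}\,\mathrm{echo}(a)\to_w\mathrm{ready}(a)$; BrEcho!: $\mathsf{Somewhere}\,\mathrm{broadcast}(a)\to_w\exists a.\mathrm{echo}(a)$; BrReady!!: $\mathsf{Contraquorum}\,\mathrm{ready}(a)\to_w\mathrm{ready}(a)$; BrCorrect: $\mathsf{Quorum}\,\mathrm{correct}(\mathrm{ready})\wedge\mathsf{Quorum}\,\mathrm{correct}(\mathrm{echo})$; BrCorrect': $\mathrm{correct}(R)\vee\mathrm{incorrect}(R)$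 for $R\in\{\mathrm{ready},\mathrm{echo}\}$; BrCorrect'': $\mathsf{Everywhere}\,\mathrm{correct}(\mathrm{broadcast})\vee\mathsf{Everywhere}\,\mathrm{incorrect}(\mathrm{broadcast})$. -}

module Defs where

open import Data.Bool using (Bool; true; false)
open import Data.Product using (Σ; _×_; _,_)
open import Data.Empty using (⊥)
open import Relation.Nullary using (Dec; yes; no; ¬_)
open import Relation.Binary.PropositionalEquality using (_≡_)
open import Function.Bundles using (_⇔_)

-- Classical logic is assumed explicitly (the paper is classical);
-- it is used to compute infima/suprema over arbitrary index sets.

LEM : Set₁
LEM = (A : Set) → Dec A

-- Truth values 3 = {f < b < t}

data Three : Set where
  𝕗 𝕓 𝕥 : Three

_∧₃_ : Three → Three → Three
𝕗 ∧₃ y = 𝕗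
𝕓 ∧₃ 𝕗 = 𝕗
𝕓 ∧₃ y = 𝕓
𝕥 ∧₃ y = y

_∨₃_ : Three → Three → Three
𝕗 ∨₃ y = y
𝕓 ∨₃ 𝕥 = 𝕥
𝕓 ∨₃ y = 𝕓
𝕥 ∨₃ y = 𝕥

¬₃ : Three → Three
¬₃ 𝕗 = 𝕥
¬₃ 𝕓 = 𝕓
¬₃ 𝕥 = 𝕗

_→w_ : Three → Three → Three
x →w y = ¬₃ x ∨₃ y

T₃ : Three → Three
T₃ 𝕥 = 𝕥
T₃ _ = 𝕗

B₃ : Three → Three
B₃ 𝕓 = 𝕥
B₃ _ = 𝕗

TF₃ : Three → Three
TF₃ 𝕓 = 𝕗
TF₃ _ = 𝕥

Valid : Three → Set
Valid 𝕗 = ⊥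
Valid _ = ⊤′
  where open import Data.Unit using () renaming (⊤ to ⊤′)

⋀ : LEM → {I : Set} → (I → Three) → Three
⋀ lem {I} f with lem (Σ I λ i → f i ≡ 𝕗)
... | yes _ = 𝕗
... | no _ with lem (Σ I λ i → f i ≡ 𝕓)
...   | yes _ = 𝕓
...   | no _ = 𝕥

⋁ : LEM → {I : Set} → (I → Three) → Three
⋁ lem {I} f with lem (Σ I λ i → f i ≡ 𝕥)
... | yes _ = 𝕥
... | no _ with lem (Σ I λ i → f i ≡ 𝕓)
...   | yes _ = 𝕓
...   | no _ = 𝕗

⌜_⌝ : {A : Set} → Dec A → Three
⌜ yes _ ⌝ = 𝕥
⌜ no _ ⌝ = 𝕗

-- Semitopologies.  Subsets of P are P → Bool (all subsets, classically).

Subset : Set → Set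
Subset P = P → Bool

_∈_ : {P : Set} → P → Subset P → Set
p ∈ U = U p ≡ true

record Semitopology : Set₁ where
  field
    P    : Set
    Open : Subset P → Set
    full-open  : Open (λ _ → true)
    union-open : (S : Subset P → Set) → (∀ U → S U → Open U) →
                 (W : Subset P) →
                 (∀ p → (p ∈ W) ⇔ Σ (Subset P) (λ U → S U × p ∈ U)) →
                 Open W

module _ (τ : Semitopology) where
  open Semitopology τ

  Open⁺ : Subset P → Set
  Open⁺ U = Open U × Σ P (λ p → p ∈ U)

  ThreeTwined : Set
  ThreeTwined = (U V W : Subset P) → Open⁺ U → Open⁺ V → Open⁺ W →
                Σ P (λ p → p ∈ U × p ∈ V × p ∈ W)

  Everywhere Somewhere Quorum Contraquorum : LEM → (P → Three) → Three
  Everywhere lem f = ⋀ lem f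
  Somewhere  lem f = ⋁ lem f
  Quorum lem f =
    ⋁ lem {Σ (Subset P) Open⁺} λ { (U , _) → ⋀ lem {Σ P λ p → p ∈ U} λ { (p , _) → f p } }
  Contraquorum lem f =
    ⋀ lem {Σ (Subset P) Open⁺} λ { (U , _) → ⋁ lem {Σ P λ p → p ∈ U} λ { (p , _) → f p } }

data Sym : Set where
  broadcast echo ready deliver : Sym

record Model : Set₁ where
  field
    Val   : Set
    val₀  : Val
    space : Semitopology
  open Semitopology space public
  field
    ς : Sym → P → Val → Three

-- Denotations of formulas, as functions P → 3 (semantic combinators)

module Sem (lem : LEM) (μ : Model) where
  open Model μ

  Den : Set
  Den = P → Three

  atom : Sym → Val → Den
  atom R v p = ς R p v

  _≐_ : Val → Val → Den
  (v ≐ v') p = ⌜ lem (v ≡ v') ⌝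

  ¬' : Den → Den
  ¬' φ p = ¬₃ (φ p)

  _∧'_ _∨'_ _⇒_ : Den → Den → Den
  (φ ∧' ψ) p = φ p ∧₃ ψ p
  (φ ∨' ψ) p = φ p ∨₃ ψ p
  (φ ⇒ ψ) p = φ p →w ψ p

  T' B' TF' : Den → Den
  T' φ p = T₃ (φ p)
  B' φ p = B₃ (φ p)
  TF' φ p = TF₃ (φ p)

  Everywhere' Somewhere' Quorum' Contraquorum' : Den → Den
  Everywhere' φ _ = Everywhere space lem φ
  Somewhere' φ _ = Somewhere space lem φ
  Quorum' φ _ = Quorum space lem φ
  Contraquorum' φ _ = Contraquorum space lem φ

  Ex All : (Val → Den) → Den
  Ex φ p = ⋁ lem (λ v → φ v p)
  All φ p = ⋀ lem (λ v → φ v p)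

  Ex01 : (Val → Den) → Den
  Ex01 φ p = ⋀ lem (λ v → ⋀ lem (λ v' → ((φ v p) ∧₃ (φ v' p)) →w (v ≐ v') p))

  Ex1 : (Val → Den) → Den
  Ex1 φ = Ex01 φ ∧' Ex φ

  correct incorrect : Sym → Den
  correct R = All (λ a → TF' (atom R a))
  incorrect R = All (λ a → B' (atom R a))

  ⊨_ : Den → Set
  ⊨ φ = (p : P) → Valid (φ p)

  -- validity of an axiom with free variable a (universally quantified)
  ⊨∀_ : (Val → Den) → Set
  ⊨∀ φ = ⊨ All φ

  record ThyBB : Set where
    field
      BrDeliver? : ⊨∀ λ a → atom deliver a ⇒ Quorum' (atom ready a)
      BrReady?   : ⊨∀ λ a → atom ready a ⇒ Quorum' (atom echo a)
      BrEcho?    : ⊨∀ λ a → atom echo a ⇒ Somewhere' (atom broadcast a)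
      BrEcho01   : ⊨ Ex01 (atom echo)
      BrBroadcast1 : ⊨ Ex1 (λ a → Somewhere' (atom broadcast a))
      BrDeliver! : ⊨∀ λ a → Quorum' (atom ready a) ⇒ atom deliver a
      BrReady!   : ⊨∀ λ a → Quorum' (atom echo a) ⇒ atom ready a
      BrEcho!    : ⊨∀ λ a → Somewhere' (atom broadcast a) ⇒ Ex (atom echo)
      BrReady!!  : ⊨∀ λ a → Contraquorum' (atom ready a) ⇒ atom ready a
      BrCorrect  : ⊨ (Quorum' (correct ready) ∧' Quorum' (correct echo))
      BrCorrect'-ready : ⊨ (correct ready ∨' incorrect ready)
      BrCorrect'-echo  : ⊨ (correct echo ∨' incorrect echo)
      BrCorrect''      : ⊨ (Everywhere' (correct broadcast) ∨' Everywhere' (incorrect broadcast))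

-- Start from a point where deliver(v) is t.  BrDeliver? yields a quorum on which
-- ready(v) is valid; by twinedness it meets the quorum on which ready is correct
-- (never b), so ready(v) is t at some point.  BrReady? then gives a quorum on which
-- echo(v) is valid, which likewise meets the correct-echo quorum, so echo(v) is t
-- somewhere, and BrEcho? gives Somewhere broadcast(v).
module Submission where

open import Defs
open import Data.Product using (Σ; _×_; _,_; proj₁; proj₂)
open import Data.Empty using (⊥-elim)
open import Data.Unit using (tt)
open import Relation.Nullary using (yes; no; ¬_)
open import Relation.Binary.PropositionalEquality using (_≡_; refl)

valid-≢𝕗 : ∀ x → ¬ x ≡ 𝕗 → Valid x
valid-≢𝕗 𝕗 x≢𝕗 = x≢𝕗 refl
valid-≢𝕗 𝕓 _   = tt
valid-≢𝕗 𝕥 _   = tt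

valid-≡𝕥 : ∀ {x} → x ≡ 𝕥 → Valid x
valid-≡𝕥 refl = tt

valid-≡𝕓 : ∀ {x} → x ≡ 𝕓 → Valid x
valid-≡𝕓 refl = tt

⋁-valid⇒∃ : (lem : LEM) {I : Set} (f : I → Three) →
            Valid (⋁ lem f) → Σ I λ i → Valid (f i)
⋁-valid⇒∃ lem {I} f h with lem (Σ I λ i → f i ≡ 𝕥)
... | yes (i , fi≡𝕥) = i , valid-≡𝕥 fi≡𝕥
... | no _ with lem (Σ I λ i → f i ≡ 𝕓)
...   | yes (i , fi≡𝕓) = i , valid-≡𝕓 fi≡𝕓
...   | no _ = ⊥-elim h

⋀-valid⇒∀ : (lem : LEM) {I : Set} (f : I → Three) →
            Valid (⋀ lem f) → (i : I) → Valid (f i)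
⋀-valid⇒∀ lem {I} f h i with lem (Σ I λ i → f i ≡ 𝕗)
... | yes _ = ⊥-elim h
... | no ∄𝕗 = valid-≢𝕗 (f i) (λ fi≡𝕗 → ∄𝕗 (i , fi≡𝕗))

∧₃-valid⇒× : ∀ x y → Valid (x ∧₃ y) → Valid x × Valid y
∧₃-valid⇒× 𝕓 𝕓 _ = tt , tt
∧₃-valid⇒× 𝕓 𝕥 _ = tt , tt
∧₃-valid⇒× 𝕥 𝕓 _ = tt , tt
∧₃-valid⇒× 𝕥 𝕥 _ = tt , tt

-- Weak implication only supports modus ponens from a true (not merely valid) antecedent.
→w-mp : ∀ {x y} → x ≡ 𝕥 → Valid (x →w y) → Valid y
→w-mp {y = 𝕓} refl _ = tt
→w-mp {y = 𝕥} refl _ = tt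

→w-intro : ∀ x y → (x ≡ 𝕥 → Valid y) → Valid (x →w y)
→w-intro 𝕗 y _ = tt
→w-intro 𝕓 𝕗 _ = tt
→w-intro 𝕓 𝕓 _ = tt
→w-intro 𝕓 𝕥 _ = tt
→w-intro 𝕥 y h = h refl

valid∧TF₃-valid⇒≡𝕥 : ∀ {x} → Valid x → Valid (TF₃ x) → x ≡ 𝕥
valid∧TF₃-valid⇒≡𝕥 {𝕥} _ _ = refl

module _ (τ : Semitopology) where
  open Semitopology τ

  ThreeTwined⇒Open⁺-intersect : ThreeTwined τ → (U V : Subset P) →
    Open⁺ τ U → Open⁺ τ V → Σ P λ p → p ∈ U × p ∈ V
  ThreeTwined⇒Open⁺-intersect twined U V U⁺ V⁺ with twined U V V U⁺ V⁺ V⁺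
  ... | p , p∈U , p∈V , _ = p , p∈U , p∈V

  Quorum-valid⇒∃Open⁺ : (lem : LEM) (f : P → Three) → Valid (Quorum τ lem f) →
    Σ (Subset P) λ U → Open⁺ τ U × (∀ p → p ∈ U → Valid (f p))
  Quorum-valid⇒∃Open⁺ lem f h with ⋁-valid⇒∃ lem _ h
  ... | (U , U⁺) , valid-on-U = U , U⁺ , λ p p∈U → ⋀-valid⇒∀ lem _ valid-on-U (p , p∈U)

module _ (lem : LEM) (μ : Model) where
  open Model μ
  open Sem lem μ

  ⊨∀-instance : {φ : Val → Den} → ⊨∀ φ → ∀ v p → Valid (φ v p)
  ⊨∀-instance ⊨φ v p = ⋀-valid⇒∀ lem _ (⊨φ p) v

  correct-valid⇒TF₃-valid : ∀ R p → Valid (correct R p) → ∀ v → Valid (TF₃ (ς R p v))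
  correct-valid⇒TF₃-valid R p = ⋀-valid⇒∀ lem _

  Quorum-valid∧Quorum-correct⇒∃≡𝕥 : ThreeTwined space → ∀ R v →
    Valid (Quorum space lem (atom R v)) → Valid (Quorum space lem (correct R)) →
    Σ P λ q → ς R q v ≡ 𝕥
  Quorum-valid∧Quorum-correct⇒∃≡𝕥 twined R v valid-quorum correct-quorum
    with Quorum-valid⇒∃Open⁺ space lem _ valid-quorum
       | Quorum-valid⇒∃Open⁺ space lem _ correct-quorum
  ... | U , U⁺ , valid-on-U | V , V⁺ , correct-on-V
    with ThreeTwined⇒Open⁺-intersect space twined U V U⁺ V⁺
  ... | q , q∈U , q∈V =
    q , valid∧TF₃-valid⇒≡𝕥 (valid-on-U q q∈U) (correct-valid⇒TF₃-valid R q (correct-on-V q q∈V) v)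

proposition4p18 : (lem : LEM) (μ : Model) →
    ThreeTwined (Model.space μ) →
    Sem.ThyBB lem μ →
    (v : Model.Val μ) →
    Sem.⊨_ lem μ (Sem._⇒_ lem μ (Sem.atom lem μ deliver v)
    (Sem.Somewhere' lem μ (Sem.atom lem μ broadcast v)))
proposition4p18 lem μ twined thy v p = →w-intro _ _ deliver⇒broadcast
  where
  open Model μ
  open Sem lem μ
  open ThyBB thy

  ready-correct : Valid (Quorum space lem (correct ready))
  ready-correct = proj₁ (∧₃-valid⇒× _ _ (BrCorrect p))

  echo-correct : Valid (Quorum space lem (correct echo))
  echo-correct = proj₂ (∧₃-valid⇒× _ _ (BrCorrect p))

  deliver⇒broadcast : ς deliver p v ≡ 𝕥 → Valid (Somewhere space lem (atom broadcast v))
  deliver⇒broadcast delivered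
    with Quorum-valid∧Quorum-correct⇒∃≡𝕥 lem μ twined ready v
           (→w-mp delivered (⊨∀-instance lem μ BrDeliver? v p)) ready-correct
  ... | q , readied
    with Quorum-valid∧Quorum-correct⇒∃≡𝕥 lem μ twined echo v
           (→w-mp readied (⊨∀-instance lem μ BrReady? v q)) echo-correct
  ... | q′ , echoed = →w-mp echoed (⊨∀-instance lem μ BrEcho? v q′)
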